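{- For every $n\in\mathbb{N}$, $$\sum_{k=0}^n(-q)^{n-k}S^o[n,k]=1.$$
   Context: $[m]=(1-q^m)/(1-q)$, $[m]!=[m]\cdots[1]$. Define $S[0,k]=\delta_{0,k}$ ($k\in\mathbb{Z}$), $S[n,k]=S[n-1,k-1]+[k]S[n-1,k]$ for $n\ge1$, and $S^o[n,k]=[k]!\,S[n,k]$. -}

module Defs where

open import Level using (Level)
open import Data.Nat using (ℕ; zero; suc; _∸_)
open import Algebra.Bundles using (CommutativeRing)

-- All q-quantities are computed in an arbitrary commutative ring R at an
-- arbitrary element q (q is a formal variable in the paper; quantifying over
-- all commutative rings and all q is equivalent to the identity in ℤ[q]).
module QDefs {c ℓ : Level} (R : CommutativeRing c ℓ) (q : CommutativeRing.Carrier R) where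
  open CommutativeRing R

  pow : Carrier → ℕ → Carrier
  pow x zero    = 1#
  pow x (suc n) = x * pow x n

  -- [m] = (1 - q^m)/(1 - q) = 1 + q + ... + q^(m-1)
  qint : ℕ → Carrier
  qint zero    = 0#
  qint (suc m) = 1# + q * qint m

  qfact : ℕ → Carrier
  qfact zero    = 1#
  qfact (suc m) = qint (suc m) * qfact m

  -- S[n,k] for k ≥ 0 (for k < 0 it is 0, which is built into the k = 0 case)
  -- S[0,k] = δ_{0,k};  S[n,k] = S[n-1,k-1] + [k] S[n-1,k]
  S : ℕ → ℕ → Carrier
  S zero    zero    = 1#
  S zero    (suc k) = 0#
  S (suc n) zero    = qint 0 * S n 0            -- S[n-1,-1] = 0
  S (suc n) (suc k) = S n k + qint (suc k) * S n (suc k)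

  So : ℕ → ℕ → Carrier
  So n k = qfact k * S n k

  sumTo : ℕ → (ℕ → Carrier) → Carrier
  sumTo zero    f = f 0
  sumTo (suc n) f = sumTo n f + f (suc n)

  lhs : ℕ → Carrier
  lhs n = sumTo n (λ k → pow (- q) (n ∸ k) * So n k)

{-# OPTIONS --safe #-}
-- Since [0] = 0, the recurrence gives
--   S°[n+1,k+1] = [k+1] (S°[n,k] + S°[n,k+1])   and   S°[n+1,0] = 0.
-- Substituting this into the sum for n+1 and shifting the index of the
-- S°[n,k+1] part splits it into Σ_k ((-q)^{n-k}[k+1] + (-q)^{n+1-k}[k]) S°[n,k],
-- and the weight collapses to (-q)^{n-k} because [k+1] = 1 + q[k].  So the sum
-- does not depend on n, and for n = 0 it is 1.
module Submission where

open import Defs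
open import Level using (Level)
open import Data.Nat using (ℕ; zero; suc; _∸_; _≤_; _<_; z≤n; s≤s)
open import Data.Nat.Properties using (+-∸-assoc; ≤-refl; m≤n⇒m≤1+n; n<1+n)
open import Algebra.Bundles using (CommutativeRing)
import Relation.Binary.PropositionalEquality as ≡
import Relation.Binary.Reasoning.Setoid as SetoidReasoning

module _ {c ℓ : Level} (R : CommutativeRing c ℓ) (q : CommutativeRing.Carrier R) where
  open CommutativeRing R
  open QDefs R q
  open SetoidReasoning setoid
  open import Algebra.Solver.Ring.NaturalCoefficients.Default commutativeSemiring

  sumTo-cong : ∀ n {f g : ℕ → Carrier} → (∀ k → k ≤ n → f k ≈ g k) → sumTo n f ≈ sumTo n g
  sumTo-cong zero    f≈g = f≈g 0 z≤n
  sumTo-cong (suc n) f≈g =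
    +-cong (sumTo-cong n (λ k k≤n → f≈g k (m≤n⇒m≤1+n k≤n))) (f≈g (suc n) ≤-refl)

  sumTo-distrib-+ : ∀ n (f g : ℕ → Carrier) →
                    sumTo n (λ k → f k + g k) ≈ sumTo n f + sumTo n g
  sumTo-distrib-+ zero    f g = refl
  sumTo-distrib-+ (suc n) f g = begin
    sumTo n (λ k → f k + g k) + (f (suc n) + g (suc n))
      ≈⟨ +-congʳ (sumTo-distrib-+ n f g) ⟩
    (sumTo n f + sumTo n g) + (f (suc n) + g (suc n))
      ≈⟨ solve 4 (λ a b x y → (a :+ b) :+ (x :+ y) := (a :+ x) :+ (b :+ y)) refl
           (sumTo n f) (sumTo n g) (f (suc n)) (g (suc n)) ⟩
    (sumTo n f + f (suc n)) + (sumTo n g + g (suc n)) ∎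

  sumTo-unfoldˡ : ∀ n (f : ℕ → Carrier) → sumTo (suc n) f ≈ f 0 + sumTo n (λ k → f (suc k))
  sumTo-unfoldˡ zero    f = refl
  sumTo-unfoldˡ (suc n) f = begin
    sumTo (suc n) f + f (suc (suc n))                   ≈⟨ +-congʳ (sumTo-unfoldˡ n f) ⟩
    (f 0 + sumTo n (λ k → f (suc k))) + f (suc (suc n)) ≈⟨ +-assoc _ _ _ ⟩
    f 0 + (sumTo n (λ k → f (suc k)) + f (suc (suc n))) ∎

  sumTo-shift : ∀ n (f : ℕ → Carrier) → f 0 ≈ 0# → f (suc n) ≈ 0# →
                sumTo n (λ k → f (suc k)) ≈ sumTo n f
  sumTo-shift n f f0≈0 fn≈0 = begin
    sumTo n (λ k → f (suc k))       ≈⟨ sym (+-identityˡ _) ⟩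
    0# + sumTo n (λ k → f (suc k))  ≈⟨ +-congʳ (sym f0≈0) ⟩
    f 0 + sumTo n (λ k → f (suc k)) ≈⟨ sym (sumTo-unfoldˡ n f) ⟩
    sumTo n f + f (suc n)           ≈⟨ +-congˡ fn≈0 ⟩
    sumTo n f + 0#                  ≈⟨ +-identityʳ _ ⟩
    sumTo n f                       ∎

  S-above-diagonal : ∀ {n k} → n < k → S n k ≈ 0#
  S-above-diagonal {zero}  {suc k} _         = refl
  S-above-diagonal {suc n} {suc k} (s≤s n<k) = begin
    S n k + qint (suc k) * S n (suc k) ≈⟨ +-cong (S-above-diagonal n<k)
                                                 (*-congˡ (S-above-diagonal (m≤n⇒m≤1+n n<k))) ⟩
    0# + qint (suc k) * 0#             ≈⟨ +-identityˡ _ ⟩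
    qint (suc k) * 0#                  ≈⟨ zeroʳ _ ⟩
    0#                                 ∎

  So-suc-zero : ∀ n → So (suc n) 0 ≈ 0#
  So-suc-zero n = trans (*-congˡ (zeroˡ _)) (zeroʳ _)

  So-suc-suc : ∀ n k → So (suc n) (suc k) ≈ qint (suc k) * (So n k + So n (suc k))
  So-suc-suc n k = solve 4 (λ a f s t → a :* f :* (s :+ a :* t) := a :* (f :* s :+ a :* f :* t))
    refl (qint (suc k)) (qfact k) (S n k) (S n (suc k))

  qint-suc-weight : ∀ x k → x * qint (suc k) + (- q * x) * qint k ≈ x
  qint-suc-weight x k = begin
    x * (1# + q * qint k) + (- q * x) * qint k
      ≈⟨ solve 4 (λ x q -q i → x :* (con 1 :+ q :* i) :+ (-q :* x) :* i
                               := x :+ (q :+ -q) :* (x :* i)) refl x q (- q) (qint k) ⟩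
    x + (q - q) * (x * qint k)  ≈⟨ +-congˡ (trans (*-congʳ (-‿inverseʳ q)) (zeroˡ _)) ⟩
    x + 0#                      ≈⟨ +-identityʳ x ⟩
    x                           ∎

  lhs-suc : ∀ n → lhs (suc n) ≈ lhs n
  lhs-suc n = begin
    lhs (suc n)                                      ≈⟨ sumTo-unfoldˡ n term ⟩
    term 0 + sumTo n (λ k → term (suc k))            ≈⟨ +-cong term0≈0 (sumTo-cong n (λ k _ → term-suc k)) ⟩
    0# + sumTo n (λ k → left k + right (suc k))      ≈⟨ +-identityˡ _ ⟩
    sumTo n (λ k → left k + right (suc k))           ≈⟨ sumTo-distrib-+ n left (λ k → right (suc k)) ⟩
    sumTo n left + sumTo n (λ k → right (suc k))     ≈⟨ +-congˡ (sumTo-shift n right right0≈0 right-top≈0) ⟩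
    sumTo n left + sumTo n right                     ≈⟨ sym (sumTo-distrib-+ n left right) ⟩
    sumTo n (λ k → left k + right k)                 ≈⟨ sumTo-cong n collapse ⟩
    lhs n                                            ∎
    where
    w : ℕ → Carrier
    w k = pow (- q) (n ∸ k)
    term left right : ℕ → Carrier
    term  k = pow (- q) (suc n ∸ k) * So (suc n) k
    left  k = w k * qint (suc k) * So n k
    right k = pow (- q) (suc n ∸ k) * qint k * So n k

    term0≈0 : term 0 ≈ 0#
    term0≈0 = trans (*-congˡ (So-suc-zero n)) (zeroʳ _)

    term-suc : ∀ k → term (suc k) ≈ left k + right (suc k)
    term-suc k = begin
      w k * So (suc n) (suc k)                   ≈⟨ *-congˡ (So-suc-suc n k) ⟩
      w k * (qint (suc k) * (So n k + So n (suc k)))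
        ≈⟨ solve 4 (λ p a s t → p :* (a :* (s :+ t)) := p :* a :* s :+ p :* a :* t) refl
             (w k) (qint (suc k)) (So n k) (So n (suc k)) ⟩
      left k + right (suc k)                     ∎

    right0≈0 : right 0 ≈ 0#
    right0≈0 = trans (*-congʳ (zeroʳ _)) (zeroˡ _)

    right-top≈0 : right (suc n) ≈ 0#
    right-top≈0 = trans (*-congˡ (trans (*-congˡ (S-above-diagonal (n<1+n n))) (zeroʳ _))) (zeroʳ _)

    collapse : ∀ k → k ≤ n → left k + right k ≈ w k * So n k
    collapse k k≤n = begin
      left k + right k
        ≈⟨ +-congˡ (*-congʳ (*-congʳ (reflexive (≡.cong (pow (- q)) (+-∸-assoc 1 k≤n))))) ⟩
      w k * qint (suc k) * So n k + (- q * w k) * qint k * So n k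
        ≈⟨ sym (distribʳ _ _ _) ⟩
      (w k * qint (suc k) + (- q * w k) * qint k) * So n k
        ≈⟨ *-congʳ (qint-suc-weight (w k) k) ⟩
      w k * So n k ∎

  lhs≈1 : ∀ n → lhs n ≈ 1#
  lhs≈1 zero    = trans (*-identityˡ _) (*-identityˡ _)
  lhs≈1 (suc n) = trans (lhs-suc n) (lhs≈1 n)

theorem5p5 : ∀ {c ℓ} (R : CommutativeRing c ℓ) (q : CommutativeRing.Carrier R) (n : ℕ) →
    CommutativeRing._≈_ R (QDefs.lhs R q n) (CommutativeRing.1# R)
theorem5p5 R q n = lhs≈1 R q n
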